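{- Let $a,a'\in\mathbb{R}^+$, $b,b'\in\mathbb{R}$, $\delta\in\mathbb{Z}^+$ and let $\ell$ be a positive integer satisfying \[ 2a\ge\delta>a',\qquad (\delta-a')\ell>(2a-a')\delta, \] \[ (\delta-a')\ell^2-\big((2a-a')\delta+b'-\delta+a'\big)\ell-(2a-a'+2b-b')\delta>0. \] Let $G$ be a graph with $n$ vertices, at most $an+b$ edges, and minimum degree $\delta$, such that every spanning bipartite subgraph of $G$ has at most $a'n+b'$ edges. Then $G$ has an $(\ell-1)$-light edge.
   Context: An edge is $m$-light if both its endpoints have degree at most $m$.
   Formalization: The parameters a, a′ range over the positive rationals and b, b′ over ℚ, rather than over $\mathbb{R}^+$ and $\mathbb{R}$. -}

module Defs where

open import Data.Bool using (Bool; true; false; if_then_else_; _∧_)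
open import Data.Nat using (ℕ; _≤_; _<ᵇ_; _∸_)
open import Data.Fin using (Fin; toℕ)
open import Data.List using (List; map; allFin)
open import Data.Nat.ListAction using (sum)
open import Data.Product using (Σ; ∃; ∃-syntax; _×_)
open import Relation.Binary.PropositionalEquality using (_≡_; _≢_)
open import Data.Integer using (+_)
open import Data.Rational using (ℚ; _/_)

record Graph (n : ℕ) : Set where
  field
    adj    : Fin n → Fin n → Bool
    sym    : ∀ i j → adj i j ≡ adj j i
    irrefl : ∀ i → adj i i ≡ false
open Graph public

b2n : Bool → ℕ
b2n true  = 1
b2n false = 0

degree : ∀ {n} → Graph n → Fin n → ℕ
degree {n} G i = sum (map (λ j → b2n (adj G i j)) (allFin n))

edgeCount : ∀ {n} → Graph n → ℕ
edgeCount {n} G =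
  sum (map (λ i → sum (map (λ j → b2n (adj G i j ∧ (toℕ i <ᵇ toℕ j))) (allFin n))) (allFin n))

MinDegree : ∀ {n} → Graph n → ℕ → Set
MinDegree G δ = (∀ i → δ ≤ degree G i) × (∃[ i ] degree G i ≡ δ)

SpanningSubgraph : ∀ {n} → Graph n → Graph n → Set
SpanningSubgraph H G = ∀ i j → adj H i j ≡ true → adj G i j ≡ true

Bipartite : ∀ {n} → Graph n → Set
Bipartite {n} H = Σ (Fin n → Bool) λ c → ∀ i j → adj H i j ≡ true → c i ≢ c j

HasLightEdge : ∀ {n} → Graph n → ℕ → Set
HasLightEdge G m = ∃[ i ] ∃[ j ] (adj G i j ≡ true × degree G i ≤ m × degree G j ≤ m)

ℕ→ℚ : ℕ → ℚ
ℕ→ℚ k = (+ k) / 1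

{-# OPTIONS --safe #-}
-- Suppose G has no (ℓ-1)-light edge and let S be the set of vertices of degree < ℓ.
-- Then S is independent, so the cut between S and its complement is a spanning
-- bipartite subgraph whose edges are exactly those at S, so it has vol(S) edges.
-- Writing ℓ = δ + k, every vertex v satisfies δ·deg v + k·[v ∈ S]·deg v ≥ δℓ, and
-- summing gives nδℓ ≤ 2δ·e(G) + k·e(cut).  A vertex of degree δ lies in S and has a
-- neighbour outside S, so n > ℓ.  The two edge bounds then turn these inequalities into
-- a contradiction with the quadratic hypothesis; the linear one is what forces ℓ > δ.
module Submission where

open import Data.Bool using (Bool; true; false; _∧_; _xor_)
open import Data.Bool.Properties using (xor-comm) renaming (_≟_ to _≟ᵇ_)
open import Data.Empty using (⊥; ⊥-elim)
open import Data.Fin using (Fin; toℕ)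
open import Data.Fin.Properties using (toℕ-injective; any?)
open import Data.Integer using (+_)
import Data.Integer as ℤ
import Data.Integer.Properties as ℤP
open import Data.List using (List; []; _∷_; map; allFin; length)
open import Data.List.Membership.Propositional using (_∈_)
open import Data.List.Membership.Propositional.Properties using (∈-allFin)
open import Data.List.Properties using (length-tabulate)
open import Data.List.Relation.Unary.Any using (here; there)
open import Data.Nat using (ℕ; z≤n; s≤s; _∸_; _<ᵇ_)
  renaming (_+_ to _+ℕ_; _*_ to _*ℕ_; _≤_ to _≤ℕ_; _<_ to _<ℕ_)
open import Data.Nat.Coprimality using (1-coprimeTo) renaming (sym to Coprime-sym)
open import Data.Nat.ListAction using (sum)
import Data.Nat.Properties as ℕP
open import Algebra.Properties.CommutativeSemigroup ℕP.+-commutativeSemigroup using (interchange)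
open import Data.Product using (_,_; ∃-syntax)
open import Data.Rational using (ℚ; mkℚ; 0ℚ; 1ℚ; _+_; _*_; -_; _-_; _<_; _≤_; *≤*; NonNegative; nonNegative)
import Data.Rational.Properties as ℚP
open import Data.Rational.Solver using (module +-*-Solver)
open import Function using (_∘_)
open import Relation.Binary.PropositionalEquality
  using (_≡_; _≢_; refl; trans; cong; cong₂; subst; subst₂; module ≡-Reasoning)
import Relation.Binary.PropositionalEquality as ≡
open import Relation.Nullary using (¬_; Dec; does; yes; no)
open import Relation.Nullary.Decidable using (_×-dec_; dec-true; decidable-stable)
open import Relation.Nullary.Reflects using (ofʸ; ofⁿ)

open import Defs

module _ {A : Set} where

  sum-map-cong : {f g : A → ℕ} → (∀ x → f x ≡ g x) → ∀ xs → sum (map f xs) ≡ sum (map g xs)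
  sum-map-cong f≗g []       = refl
  sum-map-cong f≗g (x ∷ xs) = cong₂ _+ℕ_ (f≗g x) (sum-map-cong f≗g xs)

  sum-map-mono : {f g : A → ℕ} → (∀ x → f x ≤ℕ g x) → ∀ xs → sum (map f xs) ≤ℕ sum (map g xs)
  sum-map-mono f≤g []       = z≤n
  sum-map-mono f≤g (x ∷ xs) = ℕP.+-mono-≤ (f≤g x) (sum-map-mono f≤g xs)

  sum-map-+ : ∀ (f g : A → ℕ) xs →
    sum (map (λ x → f x +ℕ g x) xs) ≡ sum (map f xs) +ℕ sum (map g xs)
  sum-map-+ f g []       = refl
  sum-map-+ f g (x ∷ xs) =
    trans (cong (f x +ℕ g x +ℕ_) (sum-map-+ f g xs)) (interchange (f x) (g x) _ _)

  sum-map-*ˡ : ∀ c (f : A → ℕ) xs → sum (map (λ x → c *ℕ f x) xs) ≡ c *ℕ sum (map f xs)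
  sum-map-*ˡ c f []       = ≡.sym (ℕP.*-zeroʳ c)
  sum-map-*ˡ c f (x ∷ xs) =
    trans (cong (c *ℕ f x +ℕ_) (sum-map-*ˡ c f xs)) (≡.sym (ℕP.*-distribˡ-+ c (f x) _))

  sum-map-const : ∀ c (xs : List A) → sum (map (λ _ → c) xs) ≡ length xs *ℕ c
  sum-map-const c []       = refl
  sum-map-const c (x ∷ xs) = cong (c +ℕ_) (sum-map-const c xs)

  count-pos⇒∃ : ∀ (f : A → Bool) xs → 0 <ℕ sum (map (b2n ∘ f) xs) → ∃[ x ] f x ≡ true
  count-pos⇒∃ f (x ∷ xs) pos with f x in fx
  ... | true  = x , fx
  ... | false = count-pos⇒∃ f xs pos

  count≤length : ∀ (f : A → Bool) xs → sum (map (b2n ∘ f) xs) ≤ℕ length xs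
  count≤length f []       = z≤n
  count≤length f (x ∷ xs) with f x
  ... | true  = s≤s (count≤length f xs)
  ... | false = ℕP.m≤n⇒m≤1+n (count≤length f xs)

  count<length : ∀ (f : A → Bool) {u} xs → u ∈ xs → f u ≡ false →
    sum (map (b2n ∘ f) xs) <ℕ length xs
  count<length f (x ∷ xs) (here refl) fu rewrite fu = s≤s (count≤length f xs)
  count<length f (x ∷ xs) (there u∈xs) fu with f x
  ... | true  = s≤s (count<length f xs u∈xs fu)
  ... | false = ℕP.m≤n⇒m≤1+n (count<length f xs u∈xs fu)

sum-map-swap : ∀ {A B : Set} (f : A → B → ℕ) xs ys →
  sum (map (λ x → sum (map (f x) ys)) xs) ≡ sum (map (λ y → sum (map (λ x → f x y) xs)) ys)
sum-map-swap f []       ys = ≡.sym (trans (sum-map-const 0 ys) (ℕP.*-zeroʳ (length ys)))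
sum-map-swap f (x ∷ xs) ys =
  trans (cong (sum (map (f x) ys) +ℕ_) (sum-map-swap f xs ys))
        (≡.sym (sum-map-+ (f x) (λ y → sum (map (λ x → f x y) xs)) ys))

∑ : ∀ {n} → (Fin n → ℕ) → ℕ
∑ {n} f = sum (map f (allFin n))

∑-cong : ∀ {n} {f g : Fin n → ℕ} → (∀ i → f i ≡ g i) → ∑ f ≡ ∑ g
∑-cong {n} f≗g = sum-map-cong f≗g (allFin n)

module _ {n : ℕ} (G : Graph n) where

  loopless : ∀ {i j} → adj G i j ≡ true → i ≢ j
  loopless {i} gij refl with () ← trans (≡.sym (irrefl G i)) gij

  adj-split : ∀ i j → b2n (adj G i j) ≡
    b2n (adj G i j ∧ (toℕ i <ᵇ toℕ j)) +ℕ b2n (adj G i j ∧ (toℕ j <ᵇ toℕ i))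
  adj-split i j
    with adj G i j in gij
       | toℕ i <ᵇ toℕ j | ℕP.<ᵇ-reflects-< (toℕ i) (toℕ j)
       | toℕ j <ᵇ toℕ i | ℕP.<ᵇ-reflects-< (toℕ j) (toℕ i)
  ... | false | _     | _       | _     | _       = refl
  ... | true  | true  | ofʸ i<j | true  | ofʸ j<i = ⊥-elim (ℕP.<-asym i<j j<i)
  ... | true  | true  | _       | false | _       = refl
  ... | true  | false | _       | true  | _       = refl
  ... | true  | false | ofⁿ i≮j | false | ofⁿ j≮i =
    ⊥-elim (loopless gij (toℕ-injective (ℕP.≤-antisym (ℕP.≮⇒≥ j≮i) (ℕP.≮⇒≥ i≮j))))

  ∑∑-transpose : ∀ (f : Fin n → Fin n → Bool → ℕ) →
    ∑ (λ i → ∑ λ j → f i j (adj G i j)) ≡ ∑ (λ j → ∑ λ i → f i j (adj G j i))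
  ∑∑-transpose f = trans (sum-map-swap (λ i j → f i j (adj G i j)) (allFin n) (allFin n))
    (∑-cong λ j → ∑-cong λ i → cong (f i j) (sym G i j))

  handshake : 2 *ℕ edgeCount G ≡ ∑ (degree G)
  handshake = ≡.sym (begin
    ∑ (degree G)
      ≡⟨ ∑-cong (λ i → trans (∑-cong (adj-split i)) (sum-map-+ _ _ (allFin n))) ⟩
    ∑ (λ i → ∑ (λ j → b2n (adj G i j ∧ (toℕ i <ᵇ toℕ j))) +ℕ ∑ (λ j → b2n (adj G i j ∧ (toℕ j <ᵇ toℕ i))))
      ≡⟨ sum-map-+ _ _ (allFin n) ⟩
    edgeCount G +ℕ ∑ (λ i → ∑ λ j → b2n (adj G i j ∧ (toℕ j <ᵇ toℕ i)))
      ≡⟨ cong (edgeCount G +ℕ_) (∑∑-transpose (λ i j g → b2n (g ∧ (toℕ j <ᵇ toℕ i)))) ⟩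
    edgeCount G +ℕ edgeCount G
      ≡⟨ cong (edgeCount G +ℕ_) (≡.sym (ℕP.+-identityʳ (edgeCount G))) ⟩
    2 *ℕ edgeCount G ∎)
    where open ≡-Reasoning

  degree<n : ∀ i → degree G i <ℕ n
  degree<n i = subst (degree G i <ℕ_) (length-tabulate {n = n} (λ j → j))
    (count<length (adj G i) (allFin n) (∈-allFin i) (irrefl G i))

  ∃-neighbour : ∀ i → 0 <ℕ degree G i → ∃[ j ] adj G i j ≡ true
  ∃-neighbour i = count-pos⇒∃ (adj G i) (allFin n)

Independent : ∀ {n} → Graph n → (Fin n → Bool) → Set
Independent G c = ∀ i j → adj G i j ≡ true → c i ≡ true → c j ≡ true → ⊥

volume : ∀ {n} → Graph n → (Fin n → Bool) → ℕ
volume G c = ∑ λ i → b2n (c i) *ℕ degree G i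

cut : ∀ {n} → Graph n → (Fin n → Bool) → Graph n
cut G c = record
  { adj    = λ i j → adj G i j ∧ (c i xor c j)
  ; sym    = λ i j → cong₂ _∧_ (sym G i j) (xor-comm (c i) (c j))
  ; irrefl = λ i → cong (_∧ (c i xor c i)) (irrefl G i)
  }

cut-spanning : ∀ {n} (G : Graph n) c → SpanningSubgraph (cut G c) G
cut-spanning G c i j e with adj G i j
... | true = refl

cut-bipartite : ∀ {n} (G : Graph n) c → Bipartite (cut G c)
cut-bipartite G c = c , λ i j e → xor-true⇒≢ (c i) (c j) (∧-true⇒ʳ (adj G i j) e)
  where
  ∧-true⇒ʳ : ∀ x {y} → x ∧ y ≡ true → y ≡ true
  ∧-true⇒ʳ true e = e
  xor-true⇒≢ : ∀ x y → x xor y ≡ true → x ≢ y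
  xor-true⇒≢ true  false _ ()
  xor-true⇒≢ false true  _ ()

cut-indicator : ∀ g x y → (g ≡ true → x ≡ true → y ≡ true → ⊥) →
  b2n (g ∧ (x xor y)) ≡ b2n x *ℕ b2n g +ℕ b2n y *ℕ b2n g
cut-indicator true  true  true  indep = ⊥-elim (indep refl refl refl)
cut-indicator true  true  false _     = refl
cut-indicator true  false true  _     = refl
cut-indicator true  false false _     = refl
cut-indicator false true  true  _     = refl
cut-indicator false true  false _     = refl
cut-indicator false false true  _     = refl
cut-indicator false false false _     = refl

edgeCount-cut : ∀ {n} (G : Graph n) c → Independent G c → edgeCount (cut G c) ≡ volume G c
edgeCount-cut {n} G c indep = ℕP.*-cancelˡ-≡ _ _ 2 (begin
  2 *ℕ edgeCount (cut G c)
    ≡⟨ handshake (cut G c) ⟩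
  ∑ (λ i → ∑ λ j → b2n (adj G i j ∧ (c i xor c j)))
    ≡⟨ ∑-cong (λ i → ∑-cong λ j → cut-indicator _ _ _ (indep i j)) ⟩
  ∑ (λ i → ∑ λ j → b2n (c i) *ℕ b2n (adj G i j) +ℕ b2n (c j) *ℕ b2n (adj G i j))
    ≡⟨ ∑-cong {n} (λ i → sum-map-+ _ _ (allFin n)) ⟩
  ∑ (λ i → ∑ (λ j → b2n (c i) *ℕ b2n (adj G i j)) +ℕ ∑ (λ j → b2n (c j) *ℕ b2n (adj G i j)))
    ≡⟨ sum-map-+ _ _ (allFin n) ⟩
  ∑ (λ i → ∑ λ j → b2n (c i) *ℕ b2n (adj G i j)) +ℕ ∑ (λ i → ∑ λ j → b2n (c j) *ℕ b2n (adj G i j))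
    ≡⟨ cong₂ _+ℕ_ rows (trans (∑∑-transpose G (λ i j g → b2n (c j) *ℕ b2n g)) rows) ⟩
  volume G c +ℕ volume G c
    ≡⟨ cong (volume G c +ℕ_) (≡.sym (ℕP.+-identityʳ (volume G c))) ⟩
  2 *ℕ volume G c ∎)
  where
  open ≡-Reasoning
  rows : ∑ (λ i → ∑ λ j → b2n (c i) *ℕ b2n (adj G i j)) ≡ volume G c
  rows = ∑-cong λ i → sum-map-*ˡ (b2n (c i)) (b2n ∘ adj G i) (allFin n)

weighted-sum-lower-bound : ∀ {A : Set} (d : A → ℕ) (c : A → Bool) {δ k} →
  (∀ x → δ ≤ℕ d x) → (∀ x → c x ≡ false → δ +ℕ k ≤ℕ d x) → ∀ xs →
  length xs *ℕ (δ *ℕ (δ +ℕ k)) ≤ℕ δ *ℕ sum (map d xs) +ℕ k *ℕ sum (map (λ x → b2n (c x) *ℕ d x) xs)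
weighted-sum-lower-bound d c {δ} {k} δ≤d c-false⇒ xs = begin
  length xs *ℕ (δ *ℕ (δ +ℕ k))
    ≡⟨ ≡.sym (sum-map-const _ xs) ⟩
  sum (map (λ _ → δ *ℕ (δ +ℕ k)) xs)
    ≤⟨ sum-map-mono pointwise xs ⟩
  sum (map (λ x → δ *ℕ d x +ℕ k *ℕ (b2n (c x) *ℕ d x)) xs)
    ≡⟨ sum-map-+ _ _ xs ⟩
  sum (map (λ x → δ *ℕ d x) xs) +ℕ sum (map (λ x → k *ℕ (b2n (c x) *ℕ d x)) xs)
    ≡⟨ cong₂ _+ℕ_ (sum-map-*ˡ δ d xs) (sum-map-*ˡ k _ xs) ⟩
  δ *ℕ sum (map d xs) +ℕ k *ℕ sum (map (λ x → b2n (c x) *ℕ d x) xs) ∎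
  where
  open ℕP.≤-Reasoning
  pointwise : ∀ x → δ *ℕ (δ +ℕ k) ≤ℕ δ *ℕ d x +ℕ k *ℕ (b2n (c x) *ℕ d x)
  pointwise x with c x in cx
  ... | true  = begin
    δ *ℕ (δ +ℕ k)          ≡⟨ ℕP.*-comm δ (δ +ℕ k) ⟩
    (δ +ℕ k) *ℕ δ          ≤⟨ ℕP.*-monoʳ-≤ (δ +ℕ k) (δ≤d x) ⟩
    (δ +ℕ k) *ℕ d x        ≡⟨ ℕP.*-distribʳ-+ (d x) δ k ⟩
    δ *ℕ d x +ℕ k *ℕ d x   ≡⟨ cong (λ y → δ *ℕ d x +ℕ k *ℕ y) (≡.sym (ℕP.*-identityˡ (d x))) ⟩
    δ *ℕ d x +ℕ k *ℕ (1 *ℕ d x) ∎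
  ... | false = ℕP.≤-trans (ℕP.*-monoʳ-≤ δ (c-false⇒ x cx)) (ℕP.m≤m+n _ _)

does-true⇒ : ∀ {P : Set} (p? : Dec P) → does p? ≡ true → P
does-true⇒ (yes p) _ = p

does-false⇒ : ∀ {P : Set} (p? : Dec P) → does p? ≡ false → ¬ P
does-false⇒ (no ¬p) _ = ¬p

hasLightEdge? : ∀ {n} (G : Graph n) m → Dec (HasLightEdge G m)
hasLightEdge? G m = any? λ i → any? λ j →
  adj G i j ≟ᵇ true ×-dec degree G i ℕP.≤? m ×-dec degree G j ℕP.≤? m

module _ {n : ℕ} (G : Graph n) (ℓ : ℕ) (¬light-edge : ¬ HasLightEdge G (ℓ ∸ 1)) where

  light : Fin n → Bool
  light i = does (degree G i ℕP.<? ℓ)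

  light⇒ : ∀ i → light i ≡ true → degree G i ≤ℕ ℓ ∸ 1
  light⇒ i = ℕP.suc[m]≤n⇒m≤pred[n] ∘ does-true⇒ (degree G i ℕP.<? ℓ)

  light⇐ : ∀ i → degree G i <ℕ ℓ → light i ≡ true
  light⇐ i = dec-true (degree G i ℕP.<? ℓ)

  heavy⇒ : ∀ i → light i ≡ false → ℓ ≤ℕ degree G i
  heavy⇒ i = ℕP.≮⇒≥ ∘ does-false⇒ (degree G i ℕP.<? ℓ)

  light-independent : Independent G light
  light-independent i j gij li lj = ¬light-edge (i , j , gij , light⇒ i li , light⇒ j lj)

  light-vertex⇒ℓ<n : ∀ v → degree G v <ℕ ℓ → 0 <ℕ degree G v → ℓ <ℕ n
  light-vertex⇒ℓ<n v v-light v-pos with ∃-neighbour G v v-pos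
  ... | j , gvj = ℕP.≤-<-trans (ℕP.≮⇒≥ j-heavy) (degree<n G j)
    where
    j-heavy : ¬ degree G j <ℕ ℓ
    j-heavy j-light = light-independent v j gvj (light⇐ v v-light) (light⇐ j j-light)

  light-cut-counting : ∀ {δ k} → ℓ ≡ δ +ℕ k → (∀ i → δ ≤ℕ degree G i) →
    n *ℕ (δ *ℕ ℓ) ≤ℕ δ *ℕ (2 *ℕ edgeCount G) +ℕ k *ℕ edgeCount (cut G light)
  light-cut-counting {δ} {k} ℓ≡δ+k δ≤deg =
    subst₂ _≤ℕ_
      (cong₂ (λ m l → m *ℕ (δ *ℕ l)) (length-tabulate {n = n} (λ i → i)) (≡.sym ℓ≡δ+k))
      (cong₂ (λ s w → δ *ℕ s +ℕ k *ℕ w) (≡.sym (handshake G)) (≡.sym (edgeCount-cut G light light-independent)))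
      (weighted-sum-lower-bound (degree G) light δ≤deg
        (λ i → subst (_≤ℕ degree G i) ℓ≡δ+k ∘ heavy⇒ i) (allFin n))

-- ℕ→ℚ normalises by a gcd computation, which is stuck on a variable k; the cast
-- lemmas below therefore go through the canonical representative.
ℕ→ℚ≡mkℚ : ∀ k → ℕ→ℚ k ≡ mkℚ (+ k) 0 (Coprime-sym (1-coprimeTo k))
ℕ→ℚ≡mkℚ k = ℚP.↥p/↧p≡p (mkℚ (+ k) 0 (Coprime-sym (1-coprimeTo k)))

ℕ→ℚ-+ : ∀ m n → ℕ→ℚ (m +ℕ n) ≡ ℕ→ℚ m + ℕ→ℚ n
ℕ→ℚ-+ m n rewrite ℕ→ℚ≡mkℚ m | ℕ→ℚ≡mkℚ n = ℚP./-cong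
  (trans (ℤP.pos-+ m n) (≡.sym (cong₂ ℤ._+_ (ℤP.*-identityʳ (+ m)) (ℤP.*-identityʳ (+ n))))) refl

ℕ→ℚ-* : ∀ m n → ℕ→ℚ (m *ℕ n) ≡ ℕ→ℚ m * ℕ→ℚ n
ℕ→ℚ-* m n rewrite ℕ→ℚ≡mkℚ m | ℕ→ℚ≡mkℚ n = ℚP./-cong (ℤP.pos-* m n) refl

ℕ→ℚ-mono-≤ : ∀ {m n} → m ≤ℕ n → ℕ→ℚ m ≤ ℕ→ℚ n
ℕ→ℚ-mono-≤ {m} {n} m≤n rewrite ℕ→ℚ≡mkℚ m | ℕ→ℚ≡mkℚ n =
  *≤* (subst₂ ℤ._≤_ (≡.sym (ℤP.*-identityʳ (+ m))) (≡.sym (ℤP.*-identityʳ (+ n))) (ℤ.+≤+ m≤n))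

ℕ→ℚ-nonNeg : ∀ k → 0ℚ ≤ ℕ→ℚ k
ℕ→ℚ-nonNeg k = ℕ→ℚ-mono-≤ {0} {k} z≤n

p<q⇒0≤q-p : ∀ {p q} → p < q → 0ℚ ≤ q - p
p<q⇒0≤q-p {p} {q} p<q = subst (_≤ q - p) (ℚP.+-inverseʳ p) (ℚP.+-monoˡ-≤ (- p) (ℚP.<⇒≤ p<q))

slack>0⇒L≰D : ∀ (a a' D L : ℚ) → 0ℚ ≤ D → D ≤ ℕ→ℚ 2 * a → a' < D →
  (ℕ→ℚ 2 * a - a') * D < (D - a') * L → ¬ (L ≤ D)
slack>0⇒L≰D a a' D L 0≤D D≤2a a'<D slack>0 L≤D = ℚP.<-irrefl refl (begin-strict
  (ℕ→ℚ 2 * a - a') * D   <⟨ slack>0 ⟩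
  (D - a') * L           ≤⟨ ℚP.*-monoˡ-≤-nonNeg (D - a') L≤D ⟩
  (D - a') * D           ≤⟨ ℚP.*-monoʳ-≤-nonNeg D (ℚP.+-monoˡ-≤ (- a') D≤2a) ⟩
  (ℕ→ℚ 2 * a - a') * D   ∎)
  where
  open ℚP.≤-Reasoning
  instance
    _ : NonNegative (D - a')
    _ = nonNegative (p<q⇒0≤q-p a'<D)
    _ : NonNegative D
    _ = nonNegative 0≤D

counting-bound-infeasible : ∀ (a a' b b' D K L E H N : ℚ) → L ≡ D + K → 0ℚ ≤ D → 0ℚ ≤ K →
  (ℕ→ℚ 2 * a - a') * D < (D - a') * L →
  0ℚ < (D - a') * L * L - ((ℕ→ℚ 2 * a - a') * D + b' - D + a') * L
        - (ℕ→ℚ 2 * a - a' + ℕ→ℚ 2 * b - b') * D →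
  E ≤ a * N + b → H ≤ a' * N + b' →
  N * (D * L) ≤ D * (ℕ→ℚ 2 * E) + K * H → 1ℚ + L ≤ N → ⊥
counting-bound-infeasible a a' b b' D K .(D + K) E H N refl 0≤D 0≤K slack>0 Q>0 E≤ H≤ count 1+L≤N =
  ℚP.<-irrefl refl (begin-strict
    R                                          ≡⟨ ≡.sym (ℚP.+-identityʳ R) ⟩
    R + 0ℚ                                     <⟨ ℚP.+-monoʳ-< R Q>0 ⟩
    R + Q                                      ≡⟨ identity ⟩
    N * (D * L) + (D * (T * E) + K * H) + P * (1ℚ + L)
      ≤⟨ ℚP.+-mono-≤ (ℚP.+-mono-≤ count edge-bounds) (ℚP.*-monoˡ-≤-nonNeg P 1+L≤N) ⟩
    R                                          ∎)
  where
  open ℚP.≤-Reasoning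
  T = ℕ→ℚ 2
  L = D + K
  P = (D - a') * L - (T * a - a') * D
  Q = (D - a') * L * L - ((T * a - a') * D + b' - D + a') * L - (T * a - a' + T * b - b') * D
  R = (D * (T * E) + K * H) + (D * (T * (a * N + b)) + K * (a' * N + b')) + P * N
  instance
    _ : NonNegative D
    _ = nonNegative 0≤D
    _ : NonNegative K
    _ = nonNegative 0≤K
    _ : NonNegative P
    _ = nonNegative (p<q⇒0≤q-p slack>0)
  edge-bounds : D * (T * E) + K * H ≤ D * (T * (a * N + b)) + K * (a' * N + b')
  edge-bounds = ℚP.+-mono-≤ (ℚP.*-monoˡ-≤-nonNeg D (ℚP.*-monoˡ-≤-nonNeg T E≤)) (ℚP.*-monoˡ-≤-nonNeg K H≤)
  open +-*-Solver using (_:+_; _:*_; _:-_; _:=_; con)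
  -- Q = P (1 + L) - D·2b - K b'  and  N D L = D·2aN + K a'N + P N.
  identity : R + Q ≡ N * (D * L) + (D * (T * E) + K * H) + P * (1ℚ + L)
  identity = +-*-Solver.solve 10 (λ a a' b b' D K E H N T →
      let L = D :+ K
          P = (D :- a') :* L :- (T :* a :- a') :* D
          Q = (D :- a') :* L :* L :- ((T :* a :- a') :* D :+ b' :- D :+ a') :* L
                :- (T :* a :- a' :+ T :* b :- b') :* D
      in (D :* (T :* E) :+ K :* H) :+ (D :* (T :* (a :* N :+ b)) :+ K :* (a' :* N :+ b')) :+ P :* N :+ Q
         := N :* (D :* L) :+ (D :* (T :* E) :+ K :* H) :+ P :* (con 1ℚ :+ L))
    refl a a' b b' D K E H N T

ℕ-counting-bound-infeasible : ∀ (a a' b b' : ℚ) (δ k ℓ e h n : ℕ) → ℓ ≡ δ +ℕ k →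
  (ℕ→ℚ 2 * a - a') * ℕ→ℚ δ < (ℕ→ℚ δ - a') * ℕ→ℚ ℓ →
  0ℚ < (ℕ→ℚ δ - a') * ℕ→ℚ ℓ * ℕ→ℚ ℓ - ((ℕ→ℚ 2 * a - a') * ℕ→ℚ δ + b' - ℕ→ℚ δ + a') * ℕ→ℚ ℓ
        - (ℕ→ℚ 2 * a - a' + ℕ→ℚ 2 * b - b') * ℕ→ℚ δ →
  ℕ→ℚ e ≤ a * ℕ→ℚ n + b → ℕ→ℚ h ≤ a' * ℕ→ℚ n + b' →
  n *ℕ (δ *ℕ ℓ) ≤ℕ δ *ℕ (2 *ℕ e) +ℕ k *ℕ h → ℓ <ℕ n → ⊥
ℕ-counting-bound-infeasible a a' b b' δ k ℓ e h n ℓ≡δ+k slack>0 Q>0 e≤ h≤ count ℓ<n =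
  counting-bound-infeasible a a' b b' (ℕ→ℚ δ) (ℕ→ℚ k) (ℕ→ℚ ℓ) (ℕ→ℚ e) (ℕ→ℚ h) (ℕ→ℚ n)
    (trans (cong ℕ→ℚ ℓ≡δ+k) (ℕ→ℚ-+ δ k)) (ℕ→ℚ-nonNeg δ) (ℕ→ℚ-nonNeg k) slack>0 Q>0 e≤ h≤
    (subst₂ _≤_
      (trans (ℕ→ℚ-* n (δ *ℕ ℓ)) (cong (ℕ→ℚ n *_) (ℕ→ℚ-* δ ℓ)))
      (trans (ℕ→ℚ-+ (δ *ℕ (2 *ℕ e)) (k *ℕ h))
        (cong₂ _+_ (trans (ℕ→ℚ-* δ (2 *ℕ e)) (cong (ℕ→ℚ δ *_) (ℕ→ℚ-* 2 e))) (ℕ→ℚ-* k h)))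
      (ℕ→ℚ-mono-≤ count))
    (subst (_≤ ℕ→ℚ n) (ℕ→ℚ-+ 1 ℓ) (ℕ→ℚ-mono-≤ ℓ<n))

lemma19 : (a a' b b' : ℚ) (δ ℓ : ℕ) →
    0ℚ < a → 0ℚ < a' → 1 ≤ℕ δ → 1 ≤ℕ ℓ →
    ℕ→ℚ δ ≤ ℕ→ℚ 2 * a → a' < ℕ→ℚ δ →
    (ℕ→ℚ 2 * a - a') * ℕ→ℚ δ < (ℕ→ℚ δ - a') * ℕ→ℚ ℓ →
    0ℚ < (ℕ→ℚ δ - a') * ℕ→ℚ ℓ * ℕ→ℚ ℓ
         - ((ℕ→ℚ 2 * a - a') * ℕ→ℚ δ + b' - ℕ→ℚ δ + a') * ℕ→ℚ ℓ
         - (ℕ→ℚ 2 * a - a' + ℕ→ℚ 2 * b - b') * ℕ→ℚ δ →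
    (n : ℕ) (G : Graph n) →
    ℕ→ℚ (edgeCount G) ≤ a * ℕ→ℚ n + b →
    MinDegree G δ →
    ((H : Graph n) → SpanningSubgraph H G → Bipartite H →
       ℕ→ℚ (edgeCount H) ≤ a' * ℕ→ℚ n + b') →
    HasLightEdge G (ℓ ∸ 1)
lemma19 a a' b b' δ ℓ _ _ 1≤δ _ δ≤2a a'<δ slack>0 Q>0 n G E≤ (δ≤deg , v , deg-v≡δ) bipartite≤ =
  decidable-stable (hasLightEdge? G (ℓ ∸ 1)) λ ¬light-edge →
    let S = light G ℓ ¬light-edge
        H = cut G S
    in ℕ-counting-bound-infeasible a a' b b' δ (ℓ ∸ δ) ℓ (edgeCount G) (edgeCount H) n ℓ≡δ+k slack>0 Q>0 E≤
      (bipartite≤ H (cut-spanning G S) (cut-bipartite G S))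
      (light-cut-counting G ℓ ¬light-edge ℓ≡δ+k δ≤deg)
      (light-vertex⇒ℓ<n G ℓ ¬light-edge v
        (subst (_<ℕ ℓ) (≡.sym deg-v≡δ) δ<ℓ) (subst (0 <ℕ_) (≡.sym deg-v≡δ) 1≤δ))
  where
  δ<ℓ : δ <ℕ ℓ
  δ<ℓ = ℕP.≰⇒> λ ℓ≤δ →
    slack>0⇒L≰D a a' (ℕ→ℚ δ) (ℕ→ℚ ℓ) (ℕ→ℚ-nonNeg δ) δ≤2a a'<δ slack>0 (ℕ→ℚ-mono-≤ ℓ≤δ)
  ℓ≡δ+k : ℓ ≡ δ +ℕ (ℓ ∸ δ)
  ℓ≡δ+k = ≡.sym (ℕP.m+[n∸m]≡n (ℕP.<⇒≤ δ<ℓ))
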